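{- Let $(\mathbf{p},I)$ be a coloring problem on a finite set $N$, with relative order complex $(\Delta(\mathbf{p}),\Gamma(\mathbf{p},I))$. Then for every integer $n\ge 0$, the Hilbert function of the relative Stanley–Reisner module satisfies $H(\Delta(\mathbf{p}),\Gamma(\mathbf{p},I))(n)=\chi(\mathbf{p},I,n+1)$.
   Context: A coloring problem on a finite set $N$ is a pair $(\mathbf{p},I)$ where $\mathbf{p}$ is a family of subsets of $N$ with $\emptyset,N\in\mathbf{p}$, ordered by inclusion, and $I$ is an order ideal of the poset $\mathrm{Int}(\mathbf{p})$ of intervals $[S,T]$ ($S\subseteq T$ in $\mathbf{p}$, ordered by inclusion) containing $[S,S]$ for all $S\in\mathbf{p}$. A proper coloring is $f:N\to\mathbb{Z}_{>0}$ with $[f^{ -1}([k]),f^{ -1}([k+1])]\in I$ for all $k\ge0$ ($[0]=\emptyset$); $\chi(\mathbf{p},I,m)$ is the number of proper colorings with values in $\{1,\dots,m\}$. $\Delta(\mathbf{p})$ is the order complex of $\mathbf{p}$ (vertices: all elements of $\mathbf{p}$, including $\emptyset$ and $N$; faces: chains of $\mathbf{p}$). $\Gamma(\mathbf{p},I)\subseteq\Delta(\mathbf{p})$ consists of the chains $S_1\subsetneq\dots\subsetneq S_k$ of $\mathbf{p}$ ($k\ge0$) such that, with $S_0=\emptyset$ and $S_{k+1}=N$, $[S_i,S_{i+1}]\notin I$ for some $0\le i\le k$; this is a subcomplex. Over a field $\mathbb{K}$, let $R=\mathbb{K}[x_S:S\in\mathbf{p}]$; for a simplicial complex $\Sigma$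 on vertex set $\mathbf{p}$, its Stanley–Reisner ideal $I_\Sigma$ is generated by the monomials $\prod_{S\in\sigma}x_S$ with $\sigma\subseteq\mathbf{p}$ not a face of $\Sigma$. The relative Stanley–Reisner module is $I_{\Gamma}/I_{\Delta}$ with $\Gamma=\Gamma(\mathbf{p},I)$, $\Delta=\Delta(\mathbf{p})$, graded by total degree, and $H(\Delta,\Gamma)(n)$ is the dimension of its degree-$n$ component, i.e. the number of monomials of degree $n$ whose support is a face of $\Delta$ but not of $\Gamma$. -}

module Defs where

open import Data.Bool using (Bool; true; false; _∧_; _∨_; not; if_then_else_)
open import Data.Nat using (ℕ; zero; suc; _+_; _<ᵇ_; _≤ᵇ_)
open import Data.Fin using (Fin; toℕ)
open import Data.Vec using (Vec; []; _∷_; tabulate)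
open import Data.List using (List; []; _∷_; _++_; map; concatMap; filter; length; upTo)
open import Data.Product using (_×_; _,_)
open import Relation.Binary.PropositionalEquality using (_≡_)
open import Relation.Nullary.Decidable using (Dec; yes; no)
open import Data.Fin.Subset using (Subset; ⊥; ⊤; ∣_∣) public

-- The ground set N is Fin d; subsets of N are Data.Fin.Subset (true = inside).

allL : {A : Set} → (A → Bool) → List A → Bool
allL f []       = true
allL f (x ∷ xs) = f x ∧ allL f xs

subsets : (d : ℕ) → List (Subset d)
subsets zero    = [] ∷ []
subsets (suc d) = concatMap (λ S → (false ∷ S) ∷ (true ∷ S) ∷ []) (subsets d)

_⊆ᵇ_ : {d : ℕ} → Subset d → Subset d → Bool
[]      ⊆ᵇ []      = true
(s ∷ S) ⊆ᵇ (t ∷ T) = (not s ∨ t) ∧ (S ⊆ᵇ T)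

_≡ᵇ_ : {d : ℕ} → Subset d → Subset d → Bool
S ≡ᵇ T = (S ⊆ᵇ T) ∧ (T ⊆ᵇ S)

comparable : {d : ℕ} → Subset d → Subset d → Bool
comparable S T = (S ⊆ᵇ T) ∨ (T ⊆ᵇ S)

-- A family p of subsets of N = Fin d is given by its (boolean) membership
-- predicate; an interval [S,T] is represented by the pair (S , T), and I
-- is given by its boolean membership predicate on pairs.
record ColoringProblem (d : ℕ) : Set where
  field
    p        : Subset d → Bool
    I        : Subset d → Subset d → Bool
    p-empty  : p ⊥ ≡ true
    p-full   : p ⊤ ≡ true
    I-int    : ∀ S T → I S T ≡ true → (p S ≡ true) × (p T ≡ true) × ((S ⊆ᵇ T) ≡ true)
    -- I is an order ideal of Int(p) (intervals ordered by inclusion: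
    -- [S',T'] ⊆ [S,T] iff S ⊆ S' and T' ⊆ T)
    I-ideal  : ∀ S T S' T' → I S T ≡ true → p S' ≡ true → p T' ≡ true →
               (S ⊆ᵇ S') ≡ true → (S' ⊆ᵇ T') ≡ true → (T' ⊆ᵇ T) ≡ true →
               I S' T' ≡ true
    I-diag   : ∀ S → p S ≡ true → I S S ≡ true

open ColoringProblem public

allVecs : (m d : ℕ) → List (Vec (Fin m) d)
allVecs m zero    = [] ∷ []
allVecs m (suc d) = concatMap (λ v → map (λ c → c ∷ v) (allFinsL m)) (allVecs m d)
  where
  allFinsL : (m : ℕ) → List (Fin m)
  allFinsL zero    = []
  allFinsL (suc m) = Fin.zero ∷ map Fin.suc (allFinsL m)
    where import Data.Fin as Fin

-- A coloring f with values in {1,…,m} is a vector of c ∈ Fin m, with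
-- colour value toℕ c + 1.  Then f⁻¹([k]) = { i | toℕ (f i) < k }.
preimage : {m d : ℕ} → Vec (Fin m) d → ℕ → Subset d
preimage []      k = []
preimage (c ∷ f) k = (toℕ c <ᵇ k) ∷ preimage f k

-- [f⁻¹([k]), f⁻¹([k+1])] ∈ I for all k ≥ 0.  For k ≥ m both preimages
-- equal N and [N,N] ∈ I holds by assumption, so it suffices to check
-- k = 0, …, m (we check k ∈ {0,…,m}).
isProper : {d : ℕ} → ColoringProblem d → (m : ℕ) → Vec (Fin m) d → Bool
isProper P m f = allL (λ k → I P (preimage f k) (preimage f (suc k))) (upTo (suc m))

χ : {d : ℕ} → ColoringProblem d → ℕ → ℕ
χ {d} P m = length (filter (λ f → isProper P m f ≡? true) (allVecs m d))
  where
  _≡?_ : (a b : Bool) → Dec (a ≡ b)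
  _≡?_ = Data.Bool._≟_
    where import Data.Bool

vertices : {d : ℕ} → ColoringProblem d → List (Subset d)
vertices {d} P = filter (λ S → p P S ≟ᵇ true) (subsets d)
  where
  _≟ᵇ_ : (a b : Bool) → Dec (a ≡ b)
  _≟ᵇ_ = Data.Bool._≟_
    where import Data.Bool

-- all exponent vectors of length k with total degree n
-- (= all monomials of degree n in k variables)
compositions : (k n : ℕ) → List (Vec ℕ k)
compositions zero    zero    = [] ∷ []
compositions zero    (suc n) = []
compositions (suc k) n       = concatMap (λ a → map (λ e → a ∷ e) (compositions k (n ∸' a))) (upTo (suc n))
  where
  _∸'_ : ℕ → ℕ → ℕ
  _∸'_ = Data.Nat._∸_
    where import Data.Nat

sumV : {k : ℕ} → Vec ℕ k → ℕ
sumV []      = 0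
sumV (a ∷ e) = a + sumV e

support : {d : ℕ} → (vs : List (Subset d)) → Vec ℕ (length vs) → List (Subset d)
support []       []      = []
support (S ∷ vs) (a ∷ e) = if 1 ≤ᵇ a then S ∷ support vs e else support vs e

-- the set σ is a face of Δ(p): a chain (pairwise comparable)
isChain : {d : ℕ} → List (Subset d) → Bool
isChain σ = allL (λ S → allL (λ T → comparable S T) σ) σ

-- insertion sort by cardinality (a chain is strictly increasing in cardinality)
insertC : {d : ℕ} → Subset d → List (Subset d) → List (Subset d)
insertC S []       = S ∷ []
insertC S (T ∷ ts) = if ∣ S ∣ ≤ᵇ ∣ T ∣ then S ∷ T ∷ ts else T ∷ insertC S ts

sortC : {d : ℕ} → List (Subset d) → List (Subset d)
sortC []       = []
sortC (S ∷ ss) = insertC S (sortC ss)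

allConsecInI : {d : ℕ} → ColoringProblem d → List (Subset d) → Bool
allConsecInI P []           = true
allConsecInI P (S ∷ [])     = true
allConsecInI P (S ∷ T ∷ ts) = I P S T ∧ allConsecInI P (T ∷ ts)

-- for a chain S_1 ⊊ … ⊊ S_k (sorted), with S_0 = ∅ and S_{k+1} = N:
-- it is a face of Γ(p,I) iff [S_i,S_{i+1}] ∉ I for some 0 ≤ i ≤ k
inΓ : {d : ℕ} → ColoringProblem d → List (Subset d) → Bool
inΓ P σ = not (allConsecInI P (⊥ ∷ (sortC σ ++ (⊤ ∷ []))))

relevant : {d : ℕ} → (P : ColoringProblem d) → (n : ℕ) → Vec ℕ (length (vertices P)) → Bool
relevant P n e = (sumV e ≡ᴮ n) ∧ isChain (support (vertices P) e) ∧ not (inΓ P (support (vertices P) e))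
  where
  _≡ᴮ_ : ℕ → ℕ → Bool
  a ≡ᴮ b = (a ≤ᵇ b) ∧ (b ≤ᵇ a)

-- H(Δ(p), Γ(p,I))(n): number of degree-n monomials in the variables
-- x_S (S ∈ p) whose support is a face of Δ(p) but not of Γ(p,I)
H : {d : ℕ} → ColoringProblem d → ℕ → ℕ
H P n = length (filter (λ e → relevant P n e ≟ᴮ true) (compositions (length (vertices P)) n))
  where
  _≟ᴮ_ : (a b : Bool) → Dec (a ≡ b)
  _≟ᴮ_ = Data.Bool._≟_
    where import Data.Bool

-- A proper colouring f with colours 1, …, n + 1 amounts to the multichain
-- f⁻¹([1]) ⊆ ⋯ ⊆ f⁻¹([n]) in p, i.e. to the degree-n monomial ∏ₖ x_{f⁻¹([k])}.
-- Properness asks that the consecutive intervals of ∅ ⊆ f⁻¹([1]) ⊆ ⋯ ⊆ f⁻¹([n]) ⊆ N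
-- lie in I; as I contains every [S, S], this only depends on the set of
-- members, i.e. on the support of the monomial, and says exactly that the
-- support is a face of Δ(p) outside Γ(p, I). Conversely a monomial supported on a
-- chain, written as a sorted multichain, gives back the colouring. The two
-- counts agree because both maps are injective between the enumerations.

module Submission where

open import Defs
import Algebra.Properties.CommutativeSemigroup
open import Data.Bool as Bool using (Bool; true; false; _∧_; _∨_; not)
open import Data.Bool.Properties using (∨-comm)
open import Data.Fin using (Fin; toℕ) renaming (zero to fzero; suc to fsuc)
open import Data.Fin.Properties using (suc-injective; toℕ<n)
open import Data.List
  using (List; []; _∷_; _++_; length; map; concatMap; filter; replicate; applyUpTo; upTo; derun)
open import Data.List.Properties
  using ( length-++; length-replicate; length-map; length-applyUpTo; ++-identityʳ; ++-assoc
        ; map-applyUpTo; map-upTo; applyUpTo-∷ʳ; ∷-injectiveˡ; ∷-injectiveʳ)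
open import Data.List.Membership.Propositional using (_∈_; _∉_; lose)
open import Data.List.Membership.Propositional.Properties
  using ( ∈-∃++; ∈-++⁻; ∈-++⁺ˡ; ∈-++⁺ʳ; ∈-derun⁻; ∈-derun⁺; ∈-map⁺; ∈-map⁻; ∈-concatMap⁺; ∈-upTo⁺
        ; ∈-filter⁺; ∈-filter⁻)
open import Data.List.Relation.Binary.Permutation.Propositional as ↭ using (_↭_; ↭-sym; ↭-trans; prep; swap)
open import Data.List.Relation.Binary.Permutation.Propositional.Properties
  using (↭-length; ∈-resp-↭; All-resp-↭; ++⁺ˡ; shift; drop-∷)
open import Data.List.Relation.Unary.Any using (here; there)
open import Data.List.Relation.Unary.All as All using (All; []; _∷_)
import Data.List.Relation.Unary.All.Properties as All
open import Data.List.Relation.Unary.AllPairs as AllPairs using (AllPairs; []; _∷_)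
import Data.List.Relation.Unary.AllPairs.Properties as AllPairs
open import Data.List.Relation.Unary.Unique.Propositional using (Unique)
import Data.List.Relation.Unary.Unique.Propositional.Properties as Unique
open import Data.Nat using (ℕ; zero; suc; _+_; _∸_; _≤_; z≤n; s≤s; _≤ᵇ_; _<ᵇ_)
open import Data.Nat.Properties
  using ( ≤-refl; ≤-trans; ≤-antisym; <-irrefl; ≤-pred; <⇒≤; n≤1+n; m≤m+n; ≤ᵇ⇒≤; ≤⇒≤ᵇ; ≰⇒≥; <⇒<ᵇ
        ; +-identityʳ; +-assoc; +-suc; m+n∸m≡n; +-commutativeSemigroup)
open Algebra.Properties.CommutativeSemigroup +-commutativeSemigroup using (x∙yz≈y∙xz)
open import Data.Product using (_×_; _,_; proj₁; proj₂)
open import Data.Sum using (_⊎_; inj₁; inj₂)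
open import Data.Vec using (Vec; []; _∷_; head; tail)
open import Data.Vec.Properties using (≡-dec)
open import Function using (_∘_)
open import Relation.Binary.Definitions using (DecidableEquality)
open import Relation.Binary.PropositionalEquality
open import Relation.Nullary using (¬_; ¬?; Dec; yes; no; contradiction)

private
  variable
    A B : Set
    d : ℕ

∧-true⁻ˡ : ∀ {a b} → a ∧ b ≡ true → a ≡ true
∧-true⁻ˡ {true} _ = refl

∧-true⁻ʳ : ∀ {a b} → a ∧ b ≡ true → b ≡ true
∧-true⁻ʳ {true} p = p

T⇒≡true : ∀ {b} → Bool.T b → b ≡ true
T⇒≡true {true} _ = refl

≡true⇒T : ∀ {b} → b ≡ true → Bool.T b
≡true⇒T refl = _

≤ᵇ-true⇒≤ : ∀ {a b} → (a ≤ᵇ b) ≡ true → a ≤ b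
≤ᵇ-true⇒≤ {a} {b} eq = ≤ᵇ⇒≤ a b (≡true⇒T eq)

∨-true⁻ : ∀ {a b} → a ∨ b ≡ true → a ≡ true ⊎ b ≡ true
∨-true⁻ {true}  _ = inj₁ refl
∨-true⁻ {false} p = inj₂ p

allL⁻ : (f : A → Bool) {xs : List A} → allL f xs ≡ true → ∀ {x} → x ∈ xs → f x ≡ true
allL⁻ f {y ∷ xs} h (here refl) with f y | h
... | true | _ = refl
allL⁻ f {y ∷ xs} h (there x∈xs) with f y | h
... | true | h′ = allL⁻ f h′ x∈xs

allL⁺ : (f : A → Bool) {xs : List A} → (∀ {x} → x ∈ xs → f x ≡ true) → allL f xs ≡ true
allL⁺ f {[]}     h = refl
allL⁺ f {y ∷ xs} h rewrite h (here refl) = allL⁺ f (h ∘ there)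

allL-map : (f : B → Bool) (g : A → B) (xs : List A) → allL f (map g xs) ≡ allL (f ∘ g) xs
allL-map f g []       = refl
allL-map f g (x ∷ xs) = cong (f (g x) ∧_) (allL-map f g xs)

length-≤-injection : {xs : List A} {ys : List B} (g : A → B) → Unique xs →
  (∀ {x} → x ∈ xs → g x ∈ ys) → (∀ {x y} → x ∈ xs → y ∈ xs → g x ≡ g y → x ≡ y) →
  length xs ≤ length ys
length-≤-injection {xs = []} g _ _ _ = z≤n
length-≤-injection {xs = x ∷ xs} g (x∉xs ∷ u) into inj with ∈-∃++ (into (here refl))
... | ys₁ , ys₂ , refl =
  subst (suc (length xs) ≤_) (sym length-split) (s≤s (length-≤-injection g u into′ (λ p q → inj (there p) (there q))))
  where
  length-split : length (ys₁ ++ g x ∷ ys₂) ≡ suc (length (ys₁ ++ ys₂))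
  length-split = trans (length-++ ys₁) (trans (+-suc (length ys₁) (length ys₂)) (cong suc (sym (length-++ ys₁))))
  into′ : ∀ {w} → w ∈ xs → g w ∈ ys₁ ++ ys₂
  into′ w∈ with ∈-++⁻ ys₁ (into (there w∈))
  ... | inj₁ p         = ∈-++⁺ˡ p
  ... | inj₂ (here eq) = contradiction (inj (there w∈) (here refl) eq) (All.lookup x∉xs w∈ ∘ sym)
  ... | inj₂ (there p) = ∈-++⁺ʳ ys₁ p

length-filter-≤ : (p : A → Bool) (q : B → Bool) {xs : List A} {ys : List B} (g : A → B) → Unique xs →
  (∀ {x} → p x ≡ true → g x ∈ ys) → (∀ {x} → p x ≡ true → q (g x) ≡ true) →
  (∀ {x y} → p x ≡ true → p y ≡ true → g x ≡ g y → x ≡ y) →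
  length (filter (λ x → p x Bool.≟ true) xs) ≤ length (filter (λ y → q y Bool.≟ true) ys)
length-filter-≤ p q {xs} {ys} g xs-unique into preserves inj =
  length-≤-injection {ys = filter (λ y → q y Bool.≟ true) ys} g
    (Unique.filter⁺ (λ x → p x Bool.≟ true) xs-unique) into′ inj′
  where
  holds : ∀ {x} → x ∈ filter (λ x → p x Bool.≟ true) xs → p x ≡ true
  holds x∈ = proj₂ (∈-filter⁻ (λ x → p x Bool.≟ true) {xs = xs} x∈)
  into′ : ∀ {x} → x ∈ filter (λ x → p x Bool.≟ true) xs → g x ∈ filter (λ y → q y Bool.≟ true) ys
  into′ x∈ = ∈-filter⁺ (λ y → q y Bool.≟ true) (into (holds x∈)) (preserves (holds x∈))
  inj′ : ∀ {x y} → x ∈ filter (λ x → p x Bool.≟ true) xs → y ∈ filter (λ x → p x Bool.≟ true) xs →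
         g x ≡ g y → x ≡ y
  inj′ x∈ y∈ = inj (holds x∈) (holds y∈)

concatMap-unique : {f : A → List B} {xs : List A} (π : B → A) → (∀ {x z} → z ∈ f x → π z ≡ x) →
  (∀ x → Unique (f x)) → Unique xs → Unique (concatMap f xs)
concatMap-unique {f = f} {xs} π π-section f-unique xs-unique =
  Unique.concat⁺ (All.map⁺ (All.universal f-unique xs)) (AllPairs.map⁺ (AllPairs.map disjoint xs-unique))
  where
  disjoint : ∀ {x y} → x ≢ y → ∀ {v} → ¬ (v ∈ f x × v ∈ f y)
  disjoint x≢y (p , q) = x≢y (trans (sym (π-section p)) (π-section q))

∈-concatMap : (f : A → List B) {xs : List A} {x : A} {z : B} → x ∈ xs → z ∈ f x → z ∈ concatMap f xs
∈-concatMap f x∈ z∈ = ∈-concatMap⁺ f (lose x∈ z∈)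

-- Multisets

module Multiset {A : Set} (_≟_ : DecidableEquality A) where

  ⟦_⟧ : {P : Set} → Dec P → ℕ
  ⟦ yes _ ⟧ = 1
  ⟦ no  _ ⟧ = 0

  occ : A → List A → ℕ
  occ z []       = 0
  occ z (x ∷ xs) = ⟦ z ≟ x ⟧ + occ z xs

  occ-resp-↭ : ∀ z {xs ys} → xs ↭ ys → occ z xs ≡ occ z ys
  occ-resp-↭ z ↭.refl        = refl
  occ-resp-↭ z (prep x p)    = cong (⟦ z ≟ x ⟧ +_) (occ-resp-↭ z p)
  occ-resp-↭ z (swap x y p)  =
    trans (x∙yz≈y∙xz ⟦ z ≟ x ⟧ ⟦ z ≟ y ⟧ _) (cong (λ k → ⟦ z ≟ y ⟧ + (⟦ z ≟ x ⟧ + k)) (occ-resp-↭ z p))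
  occ-resp-↭ z (↭.trans p q) = trans (occ-resp-↭ z p) (occ-resp-↭ z q)

  occ-++ : ∀ z xs ys → occ z (xs ++ ys) ≡ occ z xs + occ z ys
  occ-++ z []       ys = refl
  occ-++ z (x ∷ xs) ys = trans (cong (⟦ z ≟ x ⟧ +_) (occ-++ z xs ys)) (sym (+-assoc ⟦ z ≟ x ⟧ _ _))

  occ-replicate-≡ : ∀ z a → occ z (replicate a z) ≡ a
  occ-replicate-≡ z zero    = refl
  occ-replicate-≡ z (suc a) with z ≟ z
  ... | yes _   = cong suc (occ-replicate-≡ z a)
  ... | no  z≢z = contradiction refl z≢z

  occ-replicate-≢ : ∀ {z x} a → z ≢ x → occ z (replicate a x) ≡ 0
  occ-replicate-≢ {z} {x} zero    _   = refl
  occ-replicate-≢ {z} {x} (suc a) z≢x with z ≟ x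
  ... | yes z≡x = contradiction z≡x z≢x
  ... | no  _   = occ-replicate-≢ a z≢x

  occ-∉ : ∀ {z} xs → z ∉ xs → occ z xs ≡ 0
  occ-∉     []       _   = refl
  occ-∉ {z} (x ∷ xs) z∉ with z ≟ x
  ... | yes z≡x = contradiction (here z≡x) z∉
  ... | no  _   = occ-∉ xs (z∉ ∘ there)

  replicate-occ-++-rest : ∀ x xs → replicate (occ x xs) x ++ filter (¬? ∘ (x ≟_)) xs ↭ xs
  replicate-occ-++-rest x []       = ↭.refl
  replicate-occ-++-rest x (y ∷ xs) with x ≟ y
  ... | yes refl = prep x (replicate-occ-++-rest x xs)
  ... | no  _    = ↭-trans (shift y (replicate (occ x xs) x) (filter (¬? ∘ (x ≟_)) xs))
                           (prep y (replicate-occ-++-rest x xs))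

  tally : (vs : List A) → List A → Vec ℕ (length vs)
  tally []       xs = []
  tally (v ∷ vs) xs = occ v xs ∷ tally vs xs

  expand : (vs : List A) → Vec ℕ (length vs) → List A
  expand []       []      = []
  expand (v ∷ vs) (a ∷ e) = replicate a v ++ expand vs e

  tally-cong : ∀ vs {xs ys} → (∀ {z} → z ∈ vs → occ z xs ≡ occ z ys) → tally vs xs ≡ tally vs ys
  tally-cong []       _  = refl
  tally-cong (v ∷ vs) eq = cong₂ _∷_ (eq (here refl)) (tally-cong vs (eq ∘ there))

  tally-resp-↭ : ∀ vs {xs ys} → xs ↭ ys → tally vs xs ≡ tally vs ys
  tally-resp-↭ vs p = tally-cong vs (λ {z} _ → occ-resp-↭ z p)

  ∈-expand⁻ : ∀ vs e {z} → z ∈ expand vs e → z ∈ vs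
  ∈-expand⁻ []       []      ()
  ∈-expand⁻ (v ∷ vs) (a ∷ e) z∈ with ∈-++⁻ (replicate a v) z∈
  ... | inj₁ z∈replicate = here (All.lookup (All.replicate⁺ {P = _≡ v} a refl) z∈replicate)
  ... | inj₂ z∈expand    = there (∈-expand⁻ vs e z∈expand)

  length-expand : ∀ vs e → length (expand vs e) ≡ sumV e
  length-expand []       []      = refl
  length-expand (v ∷ vs) (a ∷ e) = trans (length-++ (replicate a v)) (cong₂ _+_ (length-replicate a) (length-expand vs e))

  tally-expand : ∀ vs → Unique vs → ∀ e → tally vs (expand vs e) ≡ e
  tally-expand []       _             []      = refl
  tally-expand (v ∷ vs) (v∉vs ∷ u) (a ∷ e) = cong₂ _∷_ head-count tail-count
    where
    v∉ : ∀ {z} → z ∈ vs → z ≢ v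
    v∉ z∈ z≡v = All.lookup v∉vs z∈ (sym z≡v)
    v∉expand : v ∉ expand vs e
    v∉expand v∈ = v∉ (∈-expand⁻ vs e v∈) refl
    head-count : occ v (replicate a v ++ expand vs e) ≡ a
    head-count = begin
      occ v (replicate a v ++ expand vs e)         ≡⟨ occ-++ v (replicate a v) (expand vs e) ⟩
      occ v (replicate a v) + occ v (expand vs e)  ≡⟨ cong₂ _+_ (occ-replicate-≡ v a) (occ-∉ (expand vs e) v∉expand) ⟩
      a + 0                                        ≡⟨ +-identityʳ a ⟩
      a                                            ∎
      where open ≡-Reasoning
    tail-count : tally vs (replicate a v ++ expand vs e) ≡ e
    tail-count = trans (tally-cong vs (λ {z} z∈ → trans (occ-++ z (replicate a v) (expand vs e))
                                                       (cong (_+ occ z (expand vs e)) (occ-replicate-≢ a (v∉ z∈)))))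
                       (tally-expand vs u e)

  expand-tally : ∀ vs → Unique vs → ∀ xs → (∀ {z} → z ∈ xs → z ∈ vs) → expand vs (tally vs xs) ↭ xs
  expand-tally []       _          []      _   = ↭.refl
  expand-tally []       _          (x ∷ _) xs⊆ with () ← xs⊆ (here refl)
  expand-tally (v ∷ vs) (v∉vs ∷ u) xs      xs⊆ = ↭-trans (++⁺ˡ (replicate (occ v xs) v) rest-perm) split
    where
    rest = filter (¬? ∘ (v ≟_)) xs
    split = replicate-occ-++-rest v xs
    rest⊆ : ∀ {z} → z ∈ rest → z ∈ vs
    rest⊆ z∈ with ∈-filter⁻ (¬? ∘ (v ≟_)) {xs = xs} z∈
    ... | z∈xs , v≢z with xs⊆ z∈xs
    ... | here z≡v  = contradiction (sym z≡v) v≢z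
    ... | there z∈vs = z∈vs
    same-occ : ∀ {z} → z ∈ vs → occ z xs ≡ occ z rest
    same-occ {z} z∈ = begin
      occ z xs                                     ≡⟨ occ-resp-↭ z (↭-sym split) ⟩
      occ z (replicate (occ v xs) v ++ rest)       ≡⟨ occ-++ z (replicate (occ v xs) v) rest ⟩
      occ z (replicate (occ v xs) v) + occ z rest  ≡⟨ cong (_+ occ z rest) (occ-replicate-≢ (occ v xs) z≢v) ⟩
      occ z rest                                   ∎
      where
      open ≡-Reasoning
      z≢v : z ≢ v
      z≢v z≡v = All.lookup v∉vs z∈ (sym z≡v)
    rest-perm : expand vs (tally vs xs) ↭ rest
    rest-perm = subst (λ t → expand vs t ↭ rest) (sym (tally-cong vs same-occ)) (expand-tally vs u rest rest⊆)

module Sorted {R : A → A → Set} (antisym : ∀ {x y} → R x y → R y x → x ≡ y) where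

  StrictlySorted : List A → Set
  StrictlySorted = AllPairs (λ x y → R x y × x ≢ y)

  heads-≡ : ∀ {x y xs ys} → All (R x) xs → All (R y) ys → x ∈ y ∷ ys → y ∈ x ∷ xs → x ≡ y
  heads-≡ _  _  (here x≡y) _          = x≡y
  heads-≡ _  _  (there _)  (here y≡x) = sym y≡x
  heads-≡ Rx Ry (there x∈) (there y∈) = antisym (All.lookup Rx y∈) (All.lookup Ry x∈)

  sorted-↭⇒≡ : ∀ {xs ys} → AllPairs R xs → AllPairs R ys → xs ↭ ys → xs ≡ ys
  sorted-↭⇒≡ {[]}     {[]}     _ _ _ = refl
  sorted-↭⇒≡ {[]}     {_ ∷ _}  _ _ p with () ← ↭-length p
  sorted-↭⇒≡ {_ ∷ _}  {[]}     _ _ p with () ← ↭-length p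
  sorted-↭⇒≡ {x ∷ xs} {y ∷ ys} (Rx ∷ sx) (Ry ∷ sy) p
    with refl ← heads-≡ Rx Ry (∈-resp-↭ p (here refl)) (∈-resp-↭ (↭-sym p) (here refl))
    = cong (x ∷_) (sorted-↭⇒≡ sx sy (drop-∷ p))

  strictlySorted-same-members⇒≡ : ∀ {xs ys} → StrictlySorted xs → StrictlySorted ys →
    (∀ {z} → z ∈ xs → z ∈ ys) → (∀ {z} → z ∈ ys → z ∈ xs) → xs ≡ ys
  strictlySorted-same-members⇒≡ {[]}     {[]}     _ _ _ _ = refl
  strictlySorted-same-members⇒≡ {[]}     {_ ∷ _}  _ _ _ ys⊆ with () ← ys⊆ (here refl)
  strictlySorted-same-members⇒≡ {_ ∷ _}  {[]}     _ _ xs⊆ _ with () ← xs⊆ (here refl)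
  strictlySorted-same-members⇒≡ {x ∷ xs} {y ∷ ys} (Rx ∷ sx) (Ry ∷ sy) xs⊆ ys⊆ =
    cong₂ _∷_ x≡y (strictlySorted-same-members⇒≡ sx sy xs⊆′ ys⊆′)
    where
    x≡y : x ≡ y
    x≡y = heads-≡ (All.map proj₁ Rx) (All.map proj₁ Ry) (xs⊆ (here refl)) (ys⊆ (here refl))
    xs⊆′ : ∀ {z} → z ∈ xs → z ∈ ys
    xs⊆′ z∈ with xs⊆ (there z∈)
    ... | here refl  = contradiction x≡y (proj₂ (All.lookup Rx z∈))
    ... | there z∈ys = z∈ys
    ys⊆′ : ∀ {z} → z ∈ ys → z ∈ xs
    ys⊆′ z∈ with ys⊆ (there z∈)
    ... | here refl  = contradiction (sym x≡y) (proj₂ (All.lookup Ry z∈))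
    ... | there z∈xs = z∈xs

  derun-strictlySorted : (_≟_ : DecidableEquality A) → ∀ {xs} → AllPairs R xs → StrictlySorted (derun _≟_ xs)
  derun-strictlySorted _≟_ {[]}         _        = []
  derun-strictlySorted _≟_ {x ∷ []}     _        = [] ∷ []
  derun-strictlySorted _≟_ {x ∷ y ∷ xs} (Rx ∷ s) with x ≟ y
  ... | yes _   = derun-strictlySorted _≟_ s
  ... | no  x≢y = All.tabulate strictly-above-x ∷ derun-strictlySorted _≟_ s
    where
    strictly-above-x : ∀ {z} → z ∈ derun _≟_ (y ∷ xs) → R x z × x ≢ z
    strictly-above-x z∈ = All.lookup Rx z∈y∷xs , λ { refl → x≢y (heads-≡ Rx (AllPairs.head s) z∈y∷xs (there (here refl))) }
      where z∈y∷xs = ∈-derun⁻ _≟_ (y ∷ xs) z∈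

subsets-complete : (S : Subset d) → S ∈ subsets d
subsets-complete []          = here refl
subsets-complete (false ∷ S) = ∈-concatMap (λ S → (false ∷ S) ∷ (true ∷ S) ∷ []) (subsets-complete S) (here refl)
subsets-complete (true ∷ S)  = ∈-concatMap (λ S → (false ∷ S) ∷ (true ∷ S) ∷ []) (subsets-complete S) (there (here refl))

subsets-unique : ∀ d → Unique (subsets d)
subsets-unique zero    = [] ∷ []
subsets-unique (suc d) = concatMap-unique tail tail-section (λ _ → ((λ ()) ∷ []) ∷ [] ∷ []) (subsets-unique d)
  where
  tail-section : ∀ {S : Subset d} {z} → z ∈ (false ∷ S) ∷ (true ∷ S) ∷ [] → tail z ≡ S
  tail-section (here refl)         = refl
  tail-section (there (here refl)) = refl

module _ {m : ℕ} where

  prependAll : List (Fin m) → ∀ {d} → List (Vec (Fin m) d) → List (Vec (Fin m) (suc d))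
  prependAll colours ws = concatMap (λ v → map (_∷ v) colours) ws

  prependAll-unique : ∀ {colours d} {ws : List (Vec (Fin m) d)} →
    Unique colours → Unique ws → Unique (prependAll colours ws)
  prependAll-unique colours-unique = concatMap-unique tail tail-section (λ _ → Unique.map⁺ (cong head) colours-unique)
    where
    tail-section : ∀ {colours d} {v : Vec (Fin m) d} {w} → w ∈ map (_∷ v) colours → tail w ≡ v
    tail-section w∈ with _ , _ , refl ← ∈-map⁻ _ w∈ = refl

  prependAll-complete : ∀ {colours d} {ws : List (Vec (Fin m) d)} →
    (∀ c → c ∈ colours) → (∀ v → v ∈ ws) → ∀ w → w ∈ prependAll colours ws
  prependAll-complete {colours} all-c all-v (c ∷ v) =
    ∈-concatMap (λ v → map (_∷ v) colours) (all-v v) (∈-map⁺ (_∷ v) (all-c c))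

  prependAll-unique⁻ : ∀ {colours} → Unique (prependAll colours ([] ∷ [])) → Unique colours
  prependAll-unique⁻ {colours} u = Unique.map⁻ (subst Unique (++-identityʳ (map (_∷ []) colours)) u)

  prependAll-complete⁻ : ∀ {colours} → (∀ w → w ∈ prependAll colours ([] ∷ [])) → ∀ c → c ∈ colours
  prependAll-complete⁻ {colours} all-w c
    with _ , c∈ , refl ← ∈-map⁻ (_∷ []) (subst (c ∷ [] ∈_) (++-identityʳ (map (_∷ []) colours)) (all-w (c ∷ [])))
    = c∈

colours-suc-unique : ∀ {m} {colours : List (Fin m)} → Unique colours → Unique (fzero ∷ map fsuc colours)
colours-suc-unique u = All.map⁺ (All.universal (λ _ ()) _) ∷ Unique.map⁺ suc-injective u

colours-suc-complete : ∀ {m} {colours : List (Fin m)} → (∀ c → c ∈ colours) → ∀ c → c ∈ fzero ∷ map fsuc colours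
colours-suc-complete all-c fzero    = here refl
colours-suc-complete all-c (fsuc c) = there (∈-map⁺ fsuc (all-c c))

-- The list of colours used by allVecs is local to its definition; its
-- properties are read off allVecs m 1, the list of one-entry vectors.
allVecs-1 : ∀ m → Unique (allVecs m 1) × (∀ w → w ∈ allVecs m 1)
allVecs-1 zero    = [] , λ { (() ∷ []) }
allVecs-1 (suc m) =
  prependAll-unique (colours-suc-unique (prependAll-unique⁻ (proj₁ (allVecs-1 m)))) ([] ∷ []) ,
  prependAll-complete {ws = [] ∷ []} (colours-suc-complete (prependAll-complete⁻ (proj₂ (allVecs-1 m)))) (λ { [] → here refl })

allVecs-unique : ∀ m d → Unique (allVecs m d)
allVecs-unique m zero    = [] ∷ []
allVecs-unique m (suc d) = prependAll-unique (prependAll-unique⁻ (proj₁ (allVecs-1 m))) (allVecs-unique m d)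

allVecs-complete : ∀ m d (w : Vec (Fin m) d) → w ∈ allVecs m d
allVecs-complete m zero    []  = here refl
allVecs-complete m (suc d) w = prependAll-complete (prependAll-complete⁻ (proj₂ (allVecs-1 m))) (allVecs-complete m d) w

compositions-unique : ∀ k n → Unique (compositions k n)
compositions-unique zero    zero    = [] ∷ []
compositions-unique zero    (suc n) = []
compositions-unique (suc k) n       =
  concatMap-unique head head-section (λ a → Unique.map⁺ (cong tail) (compositions-unique k (n ∸ a))) (Unique.upTo⁺ (suc n))
  where
  head-section : ∀ {a} {e : Vec ℕ (suc k)} → e ∈ map (a ∷_) (compositions k (n ∸ a)) → head e ≡ a
  head-section e∈ with _ , _ , refl ← ∈-map⁻ _ e∈ = refl

compositions-complete : ∀ k (e : Vec ℕ k) → e ∈ compositions k (sumV e)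
compositions-complete zero    []      = here refl
compositions-complete (suc k) (a ∷ e) =
  ∈-concatMap (λ b → map (b ∷_) (compositions k (a + sumV e ∸ b))) (∈-upTo⁺ (s≤s (m≤m+n a (sumV e))))
    (∈-map⁺ (a ∷_) (subst (λ s → e ∈ compositions k s) (sym (m+n∸m≡n a (sumV e))) (compositions-complete k e)))

_⊆_ : Subset d → Subset d → Set
S ⊆ T = (S ⊆ᵇ T) ≡ true

_≟ₛ_ : DecidableEquality (Subset d)
_≟ₛ_ = ≡-dec Bool._≟_

⊆-refl : (S : Subset d) → S ⊆ S
⊆-refl []          = refl
⊆-refl (false ∷ S) = ⊆-refl S
⊆-refl (true ∷ S)  = ⊆-refl S

⊆-trans : (S T U : Subset d) → S ⊆ T → T ⊆ U → S ⊆ U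
⊆-trans []          []          []          _ _ = refl
⊆-trans (false ∷ S) (false ∷ T) (u ∷ U)     p q = ⊆-trans S T U p (∧-true⁻ʳ {not false ∨ u} q)
⊆-trans (false ∷ S) (true ∷ T)  (true ∷ U)  p q = ⊆-trans S T U p q
⊆-trans (true ∷ S)  (true ∷ T)  (true ∷ U)  p q = ⊆-trans S T U p q

⊆-antisym : (S T : Subset d) → S ⊆ T → T ⊆ S → S ≡ T
⊆-antisym []          []          _ _ = refl
⊆-antisym (false ∷ S) (false ∷ T) p q = cong (false ∷_) (⊆-antisym S T p q)
⊆-antisym (true ∷ S)  (true ∷ T)  p q = cong (true ∷_) (⊆-antisym S T p q)

p⊆q⇒∣p∣≤∣q∣ : (S T : Subset d) → S ⊆ T → ∣ S ∣ ≤ ∣ T ∣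
p⊆q⇒∣p∣≤∣q∣ []          []          _ = z≤n
p⊆q⇒∣p∣≤∣q∣ (false ∷ S) (false ∷ T) p = p⊆q⇒∣p∣≤∣q∣ S T p
p⊆q⇒∣p∣≤∣q∣ (false ∷ S) (true ∷ T)  p = ≤-trans (p⊆q⇒∣p∣≤∣q∣ S T p) (n≤1+n _)
p⊆q⇒∣p∣≤∣q∣ (true ∷ S)  (true ∷ T)  p = s≤s (p⊆q⇒∣p∣≤∣q∣ S T p)

p⊆q∧∣q∣≤∣p∣⇒p≡q : (S T : Subset d) → S ⊆ T → ∣ T ∣ ≤ ∣ S ∣ → S ≡ T
p⊆q∧∣q∣≤∣p∣⇒p≡q []          []          _ _       = refl
p⊆q∧∣q∣≤∣p∣⇒p≡q (false ∷ S) (false ∷ T) p q       = cong (false ∷_) (p⊆q∧∣q∣≤∣p∣⇒p≡q S T p q)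
p⊆q∧∣q∣≤∣p∣⇒p≡q (true ∷ S)  (true ∷ T)  p (s≤s q) = cong (true ∷_) (p⊆q∧∣q∣≤∣p∣⇒p≡q S T p q)
p⊆q∧∣q∣≤∣p∣⇒p≡q (false ∷ S) (true ∷ T)  p q       =
  contradiction (≤-trans q (p⊆q⇒∣p∣≤∣q∣ S T p)) (<-irrefl refl)

comparable∧∣p∣≤∣q∣⇒p⊆q : (S T : Subset d) → comparable S T ≡ true → ∣ S ∣ ≤ ∣ T ∣ → S ⊆ T
comparable∧∣p∣≤∣q∣⇒p⊆q S T c ∣S∣≤∣T∣ with ∨-true⁻ {S ⊆ᵇ T} c
... | inj₁ S⊆T = S⊆T
... | inj₂ T⊆S = subst (_⊆ T) (p⊆q∧∣q∣≤∣p∣⇒p≡q T S T⊆S ∣S∣≤∣T∣) (⊆-refl T)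
Comparable : List (Subset d) → Set
Comparable σ = ∀ {S T} → S ∈ σ → T ∈ σ → comparable S T ≡ true

⊆⇒comparable : (S T : Subset d) → S ⊆ T → comparable S T ≡ true
⊆⇒comparable S T S⊆T = cong (_∨ (T ⊆ᵇ S)) S⊆T

comparable-sym : (S T : Subset d) → comparable S T ≡ true → comparable T S ≡ true
comparable-sym S T c = trans (∨-comm (T ⊆ᵇ S) (S ⊆ᵇ T)) c

isChain⁻ : {σ : List (Subset d)} → isChain σ ≡ true → Comparable σ
isChain⁻ {σ = σ} h {S} S∈ T∈ = allL⁻ (comparable S) (allL⁻ (λ S → allL (comparable S) σ) h S∈) T∈

isChain⁺ : {σ : List (Subset d)} → Comparable σ → isChain σ ≡ true
isChain⁺ {σ = σ} c = allL⁺ (λ S → allL (comparable S) σ) (λ {S} S∈ → allL⁺ (comparable S) (c S∈))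

sorted⇒comparable : {L : List (Subset d)} → AllPairs _⊆_ L → Comparable L
sorted⇒comparable {L = S ∷ L} (S⊆ ∷ _)      (here refl) (here refl) = ⊆⇒comparable S S (⊆-refl S)
sorted⇒comparable {L = S ∷ L} (S⊆ ∷ _)      (here refl) (there T∈)  = ⊆⇒comparable S _ (All.lookup S⊆ T∈)
sorted⇒comparable {L = S ∷ L} (S⊆ ∷ _)      (there S∈)  (here refl) = comparable-sym S _ (⊆⇒comparable S _ (All.lookup S⊆ S∈))
sorted⇒comparable             (_ ∷ sorted) (there S∈)  (there T∈)  = sorted⇒comparable sorted S∈ T∈

insertC-↭ : (S : Subset d) (L : List (Subset d)) → insertC S L ↭ S ∷ L
insertC-↭ S []      = ↭.refl
insertC-↭ S (T ∷ L) with ∣ S ∣ ≤ᵇ ∣ T ∣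
... | true  = ↭.refl
... | false = ↭-trans (prep T (insertC-↭ S L)) (swap T S ↭.refl)

sortC-↭ : (L : List (Subset d)) → sortC L ↭ L
sortC-↭ []      = ↭.refl
sortC-↭ (S ∷ L) = ↭-trans (insertC-↭ S (sortC L)) (prep S (sortC-↭ L))

insertC-sorted : (S : Subset d) (L : List (Subset d)) →
  (∀ {T} → T ∈ L → comparable S T ≡ true) → AllPairs _⊆_ L → AllPairs _⊆_ (insertC S L)
insertC-sorted S []      _   _              = [] ∷ []
insertC-sorted S (T ∷ L) cmp (T⊆ ∷ sorted) with ∣ S ∣ ≤ᵇ ∣ T ∣ in ∣S∣≤ᵇ∣T∣
... | true  = (S⊆T ∷ All.map (λ {U} → ⊆-trans S T U S⊆T) T⊆) ∷ T⊆ ∷ sorted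
  where
  S⊆T = comparable∧∣p∣≤∣q∣⇒p⊆q S T (cmp (here refl)) (≤ᵇ-true⇒≤ ∣S∣≤ᵇ∣T∣)
... | false = All-resp-↭ (↭-sym (insertC-↭ S L)) (T⊆S ∷ T⊆) ∷ insertC-sorted S L (cmp ∘ there) sorted
  where
  T⊆S = comparable∧∣p∣≤∣q∣⇒p⊆q T S (comparable-sym S T (cmp (here refl))) (≰⇒≥ (subst Bool.T ∣S∣≤ᵇ∣T∣ ∘ ≤⇒≤ᵇ))

sortC-sorted : (L : List (Subset d)) → Comparable L → AllPairs _⊆_ (sortC L)
sortC-sorted []      _ = []
sortC-sorted (S ∷ L) c = insertC-sorted S (sortC L)
  (λ T∈ → c (here refl) (there (∈-resp-↭ (sortC-↭ L) T∈))) (sortC-sorted L (λ p q → c (there p) (there q)))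
module _ (P : ColoringProblem d) where

  framedInI : Subset d → List (Subset d) → Subset d → Bool
  framedInI a L b = allConsecInI P (a ∷ L ++ b ∷ [])

  framedInI⇒∈p : ∀ a L b → framedInI a L b ≡ true → ∀ {z} → z ∈ L → p P z ≡ true
  framedInI⇒∈p a (x ∷ L) b h (here refl) = proj₁ (proj₂ (I-int P a x (∧-true⁻ˡ h)))
  framedInI⇒∈p a (x ∷ L) b h (there z∈)  = framedInI⇒∈p x L b (∧-true⁻ʳ {I P a x} h) z∈

  framedInI-derun : ∀ a L b → (∀ {z} → z ∈ L → I P z z ≡ true) →
    framedInI a (derun _≟ₛ_ L) b ≡ framedInI a L b
  framedInI-derun a []      b _    = refl
  framedInI-derun a (x ∷ L) b diag = framedInI-derun-∷ a x L diag
    where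
    framedInI-derun-∷ : ∀ a x L → (∀ {z} → z ∈ x ∷ L → I P z z ≡ true) →
      framedInI a (derun _≟ₛ_ (x ∷ L)) b ≡ framedInI a (x ∷ L) b
    framedInI-derun-∷ a x []      _    = refl
    framedInI-derun-∷ a x (y ∷ L) diag with x ≟ₛ y
    ... | yes x≡y rewrite x≡y | diag (here refl) = framedInI-derun-∷ a y L (diag ∘ there)
    ... | no  _   = cong (I P a x ∧_) (framedInI-derun-∷ x y L (diag ∘ there))

  framedInI-same-members : ∀ a {L L′} b → AllPairs _⊆_ L → AllPairs _⊆_ L′ →
    (∀ {z} → z ∈ L → z ∈ L′) → (∀ {z} → z ∈ L′ → z ∈ L) → (∀ {z} → z ∈ L → I P z z ≡ true) →
    framedInI a L b ≡ framedInI a L′ b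
  framedInI-same-members a {L} {L′} b sorted sorted′ L⊆L′ L′⊆L diag = begin
    framedInI a L b                   ≡⟨ sym (framedInI-derun a L b diag) ⟩
    framedInI a (derun _≟ₛ_ L) b      ≡⟨ cong (λ X → framedInI a X b) derun-equal ⟩
    framedInI a (derun _≟ₛ_ L′) b     ≡⟨ framedInI-derun a L′ b (diag ∘ L′⊆L) ⟩
    framedInI a L′ b                  ∎
    where
    open ≡-Reasoning
    open Sorted (λ {S} {T} → ⊆-antisym S T)
    derun-equal : derun _≟ₛ_ L ≡ derun _≟ₛ_ L′
    derun-equal = strictlySorted-same-members⇒≡ (derun-strictlySorted _≟ₛ_ sorted) (derun-strictlySorted _≟ₛ_ sorted′)
      (∈-derun⁺ _≟ₛ_ ∘ L⊆L′ ∘ ∈-derun⁻ _≟ₛ_ L) (∈-derun⁺ _≟ₛ_ ∘ L′⊆L ∘ ∈-derun⁻ _≟ₛ_ L′)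

-- Colourings as multichains

<ᵇ-mono : ∀ a {k k′} → k ≤ k′ → (not (a <ᵇ k) ∨ (a <ᵇ k′)) ≡ true
<ᵇ-mono a       {zero}           _          = refl
<ᵇ-mono zero    {suc k} {suc k′} _          = refl
<ᵇ-mono (suc a) {suc k} {suc k′} (s≤s k≤k′) = <ᵇ-mono a k≤k′

preimage-mono : ∀ {m} (f : Vec (Fin m) d) {k k′} → k ≤ k′ → preimage f k ⊆ preimage f k′
preimage-mono []      _    = refl
preimage-mono (c ∷ f) k≤k′ rewrite <ᵇ-mono (toℕ c) k≤k′ = preimage-mono f k≤k′

preimage-zero : ∀ {m} (f : Vec (Fin m) d) → preimage f 0 ≡ ⊥
preimage-zero []      = refl
preimage-zero (c ∷ f) = cong (false ∷_) (preimage-zero f)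

preimage-top : ∀ {m} (f : Vec (Fin m) d) {k} → m ≤ k → preimage f k ≡ ⊤
preimage-top []      _   = refl
preimage-top (c ∷ f) m≤k = cong₂ _∷_ (T⇒≡true (<⇒<ᵇ (≤-trans (toℕ<n c) m≤k))) (preimage-top f m≤k)

multichain : ∀ n → Vec (Fin (suc n)) d → List (Subset d)
multichain n f = applyUpTo (λ k → preimage f (suc k)) n

multichain-sorted : ∀ n (f : Vec (Fin (suc n)) d) → AllPairs _⊆_ (multichain n f)
multichain-sorted n f = AllPairs.applyUpTo⁺₁ _ n (λ i<j _ → preimage-mono f (s≤s (<⇒≤ i<j)))

falses : List Bool → ℕ
falses []           = 0
falses (false ∷ bs) = suc (falses bs)
falses (true ∷ bs)  = falses bs

clamp : ∀ n → ℕ → Fin (suc n)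
clamp n       zero    = fzero
clamp zero    (suc k) = fzero
clamp (suc n) (suc k) = fsuc (clamp n k)

-- The colour of an element is the number of members of the multichain
-- avoiding it.
colouring : ∀ n → List (Subset d) → Vec (Fin (suc n)) d
colouring {zero}  n L = []
colouring {suc d} n L = clamp n (falses (map head L)) ∷ colouring n (map tail L)

toℕ-clamp : ∀ n k → k ≤ n → toℕ (clamp n k) ≡ k
toℕ-clamp n       zero    _         = refl
toℕ-clamp (suc n) (suc k) (s≤s k≤n) = cong suc (toℕ-clamp n k k≤n)

clamp-toℕ : ∀ n (c : Fin (suc n)) → clamp n (toℕ c) ≡ c
clamp-toℕ n       fzero    = refl
clamp-toℕ (suc n) (fsuc c) = cong fsuc (clamp-toℕ n c)

falses≤length : ∀ bs → falses bs ≤ length bs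
falses≤length []           = z≤n
falses≤length (false ∷ bs) = s≤s (falses≤length bs)
falses≤length (true ∷ bs)  = ≤-trans (falses≤length bs) (n≤1+n _)

falses-threshold : ∀ c n → c ≤ n → falses (applyUpTo (λ k → c <ᵇ suc k) n) ≡ c
falses-threshold zero    zero    _         = refl
falses-threshold zero    (suc n) _         = falses-threshold zero n z≤n
falses-threshold (suc c) (suc n) (s≤s c≤n) = cong suc (falses-threshold c n c≤n)

Monotone : List Bool → Set
Monotone = AllPairs (λ a b → (not a ∨ b) ≡ true)

falses-all-true : ∀ {bs} → All (_≡ true) bs → falses bs ≡ 0
falses-all-true []          = refl
falses-all-true (refl ∷ bs) = falses-all-true bs

all-true-applyUpTo : ∀ {bs} → All (_≡ true) bs → applyUpTo (λ _ → true) (length bs) ≡ bs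
all-true-applyUpTo []          = refl
all-true-applyUpTo (refl ∷ bs) = cong (true ∷_) (all-true-applyUpTo bs)

threshold-falses : ∀ bs → Monotone bs → applyUpTo (λ k → falses bs <ᵇ suc k) (length bs) ≡ bs
threshold-falses []           _                 = refl
threshold-falses (false ∷ bs) (_ ∷ monotone)    = cong (false ∷_) (threshold-falses bs monotone)
threshold-falses (true ∷ bs)  (all-true ∷ _) rewrite falses-all-true all-true = cong (true ∷_) (all-true-applyUpTo all-true)

map-head-tail-injective : ∀ {k} {xs ys : List (Vec A (suc k))} →
  map head xs ≡ map head ys → map tail xs ≡ map tail ys → xs ≡ ys
map-head-tail-injective {xs = []}          {[]}          _  _  = refl
map-head-tail-injective {xs = (a ∷ v) ∷ xs} {(b ∷ w) ∷ ys} hs ts =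
  cong₂ _∷_ (cong₂ _∷_ (∷-injectiveˡ hs) (∷-injectiveˡ ts))
            (map-head-tail-injective (∷-injectiveʳ hs) (∷-injectiveʳ ts))

colouring-multichain : ∀ n (f : Vec (Fin (suc n)) d) → colouring n (multichain n f) ≡ f
colouring-multichain n []      = refl
colouring-multichain n (c ∷ f) = cong₂ _∷_ colour-c (trans (cong (colouring n) tails) (colouring-multichain n f))
  where
  heads : map head (multichain n (c ∷ f)) ≡ applyUpTo (λ k → toℕ c <ᵇ suc k) n
  heads = map-applyUpTo _ head n
  tails : map tail (multichain n (c ∷ f)) ≡ multichain n f
  tails = map-applyUpTo _ tail n
  colour-c : clamp n (falses (map head (multichain n (c ∷ f)))) ≡ c
  colour-c = trans (cong (clamp n) (trans (cong falses heads) (falses-threshold (toℕ c) n (≤-pred (toℕ<n c)))))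
                   (clamp-toℕ n c)

multichain-colouring : ∀ n (L : List (Subset d)) → AllPairs _⊆_ L → length L ≡ n → multichain n (colouring n L) ≡ L
multichain-colouring {zero}  n []       _      refl = refl
multichain-colouring {zero}  n ([] ∷ L) sorted refl = cong ([] ∷_) (multichain-colouring _ L (AllPairs.tail sorted) refl)
multichain-colouring {suc d} n L        sorted refl = map-head-tail-injective heads tails
  where
  hs = map head L
  hs-monotone : Monotone hs
  hs-monotone = AllPairs.map⁺ (AllPairs.map (λ {S} {T} → head-mono S T) sorted)
    where
    head-mono : (S T : Subset (suc d)) → S ⊆ T → (not (head S) ∨ head T) ≡ true
    head-mono (s ∷ S) (t ∷ T) S⊆T = ∧-true⁻ˡ S⊆T
  tails-sorted : AllPairs _⊆_ (map tail L)
  tails-sorted = AllPairs.map⁺ (AllPairs.map (λ {S} {T} → tail-mono S T) sorted)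
    where
    tail-mono : (S T : Subset (suc d)) → S ⊆ T → tail S ⊆ tail T
    tail-mono (s ∷ S) (t ∷ T) S⊆T = ∧-true⁻ʳ {not s ∨ t} S⊆T
  colour-falses : toℕ (clamp (length L) (falses hs)) ≡ falses hs
  colour-falses = toℕ-clamp (length L) (falses hs) (subst (falses hs ≤_) (length-map head L) (falses≤length hs))
  heads : map head (multichain (length L) (colouring (length L) L)) ≡ hs
  heads = begin
    map head (multichain (length L) (colouring (length L) L))
      ≡⟨ map-applyUpTo _ head (length L) ⟩
    applyUpTo (λ k → toℕ (clamp (length L) (falses hs)) <ᵇ suc k) (length L)
      ≡⟨ cong (λ c → applyUpTo (λ k → c <ᵇ suc k) (length L)) colour-falses ⟩
    applyUpTo (λ k → falses hs <ᵇ suc k) (length L)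
      ≡⟨ cong (applyUpTo (λ k → falses hs <ᵇ suc k)) (sym (length-map head L)) ⟩
    applyUpTo (λ k → falses hs <ᵇ suc k) (length hs)
      ≡⟨ threshold-falses hs hs-monotone ⟩
    hs
      ∎
    where open ≡-Reasoning
  tails : map tail (multichain (length L) (colouring (length L) L)) ≡ map tail L
  tails = trans (map-applyUpTo _ tail (length L))
                (multichain-colouring (length L) (map tail L) tails-sorted (length-map tail L))

module _ (P : ColoringProblem d) where

  allConsecInI-applyUpTo : ∀ (G : ℕ → Subset d) j →
    allConsecInI P (applyUpTo G (suc j)) ≡ allL (λ k → I P (G k) (G (suc k))) (upTo j)
  allConsecInI-applyUpTo G zero    = refl
  allConsecInI-applyUpTo G (suc j) = cong (I P (G 0) (G 1) ∧_) (begin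
    allConsecInI P (applyUpTo (G ∘ suc) (suc j))        ≡⟨ allConsecInI-applyUpTo (G ∘ suc) j ⟩
    allL (Q ∘ suc) (upTo j)                             ≡⟨ sym (allL-map Q suc (upTo j)) ⟩
    allL Q (map suc (upTo j))                           ≡⟨ cong (allL Q) (map-upTo suc j) ⟩
    allL Q (applyUpTo suc j)                            ∎)
    where
    open ≡-Reasoning
    Q = λ k → I P (G k) (G (suc k))

  allConsecInI-∷ʳ-twice : ∀ xs y → I P y y ≡ true →
    allConsecInI P (xs ++ y ∷ y ∷ []) ≡ allConsecInI P (xs ++ y ∷ [])
  allConsecInI-∷ʳ-twice []           y Iyy rewrite Iyy = refl
  allConsecInI-∷ʳ-twice (x ∷ [])     y Iyy rewrite Iyy = refl
  allConsecInI-∷ʳ-twice (x ∷ x′ ∷ xs) y Iyy = cong (I P x x′ ∧_) (allConsecInI-∷ʳ-twice (x′ ∷ xs) y Iyy)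

  -- isProper also tests the interval [f⁻¹([n+1]), f⁻¹([n+2])] = [N, N].
  isProper≡framedInI : ∀ n (f : Vec (Fin (suc n)) d) → isProper P (suc n) f ≡ framedInI P ⊥ (multichain n f) ⊤
  isProper≡framedInI n f = begin
    isProper P (suc n) f
      ≡⟨ sym (allConsecInI-applyUpTo (preimage f) (suc (suc n))) ⟩
    allConsecInI P (preimage f 0 ∷ applyUpTo (preimage f ∘ suc) (suc (suc n)))
      ≡⟨ cong₂ (λ S L → allConsecInI P (S ∷ L)) (preimage-zero f) preimages ⟩
    allConsecInI P ((⊥ ∷ multichain n f) ++ ⊤ ∷ ⊤ ∷ [])
      ≡⟨ allConsecInI-∷ʳ-twice (⊥ ∷ multichain n f) ⊤ (I-diag P ⊤ (p-full P)) ⟩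
    framedInI P ⊥ (multichain n f) ⊤
      ∎
    where
    open ≡-Reasoning
    preimages : applyUpTo (preimage f ∘ suc) (suc (suc n)) ≡ multichain n f ++ ⊤ ∷ ⊤ ∷ []
    preimages = begin
      applyUpTo (preimage f ∘ suc) (suc (suc n))
        ≡⟨ sym (applyUpTo-∷ʳ (preimage f ∘ suc) (suc n)) ⟩
      applyUpTo (preimage f ∘ suc) (suc n) ++ preimage f (suc (suc n)) ∷ []
        ≡⟨ cong (_++ preimage f (suc (suc n)) ∷ []) (sym (applyUpTo-∷ʳ (preimage f ∘ suc) n)) ⟩
      (multichain n f ++ preimage f (suc n) ∷ []) ++ preimage f (suc (suc n)) ∷ []
        ≡⟨ cong₂ (λ S T → (multichain n f ++ S ∷ []) ++ T ∷ []) (preimage-top f ≤-refl) (preimage-top f (n≤1+n _)) ⟩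
      (multichain n f ++ ⊤ ∷ []) ++ ⊤ ∷ []
        ≡⟨ ++-assoc (multichain n f) _ _ ⟩
      multichain n f ++ ⊤ ∷ ⊤ ∷ []
        ∎

-- Monomials

module _ {d : ℕ} where
  open Multiset (_≟ₛ_ {d})

  ∈-support⇒∈-expand : ∀ (vs : List (Subset d)) e {z} → z ∈ support vs e → z ∈ expand vs e
  ∈-support⇒∈-expand []       []          ()
  ∈-support⇒∈-expand (v ∷ vs) (zero  ∷ e) z∈         = ∈-support⇒∈-expand vs e z∈
  ∈-support⇒∈-expand (v ∷ vs) (suc a ∷ e) (here z≡v) = here z≡v
  ∈-support⇒∈-expand (v ∷ vs) (suc a ∷ e) (there z∈) = there (∈-++⁺ʳ (replicate a v) (∈-support⇒∈-expand vs e z∈))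

  ∈-expand⇒∈-support : ∀ (vs : List (Subset d)) e {z} → z ∈ expand vs e → z ∈ support vs e
  ∈-expand⇒∈-support []       []          ()
  ∈-expand⇒∈-support (v ∷ vs) (zero  ∷ e) z∈         = ∈-expand⇒∈-support vs e z∈
  ∈-expand⇒∈-support (v ∷ vs) (suc a ∷ e) (here z≡v) = here z≡v
  ∈-expand⇒∈-support (v ∷ vs) (suc a ∷ e) (there z∈) with ∈-++⁻ (replicate a v) z∈
  ... | inj₁ z∈replicate = here (All.lookup (All.replicate⁺ {P = _≡ v} a refl) z∈replicate)
  ... | inj₂ z∈expand    = there (∈-expand⇒∈-support vs e z∈expand)

module _ (P : ColoringProblem d) where

  ∈-vertices⁺ : ∀ {S} → p P S ≡ true → S ∈ vertices P
  ∈-vertices⁺ {S} pS = ∈-filter⁺ (λ S → p P S Bool.≟ true) (subsets-complete S) pS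

  ∈-vertices⁻ : ∀ {S} → S ∈ vertices P → p P S ≡ true
  ∈-vertices⁻ S∈ = proj₂ (∈-filter⁻ (λ S → p P S Bool.≟ true) {xs = subsets _} S∈)

  vertices-unique : Unique (vertices P)
  vertices-unique = Unique.filter⁺ (λ S → p P S Bool.≟ true) (subsets-unique _)

  relevant⁺ : ∀ n e → sumV e ≡ n → isChain (support (vertices P) e) ≡ true →
    framedInI P ⊥ (sortC (support (vertices P) e)) ⊤ ≡ true → relevant P n e ≡ true
  relevant⁺ n e refl chain framed rewrite T⇒≡true (≤⇒≤ᵇ (≤-refl {sumV e})) | chain | framed = refl

  relevant⁻ : ∀ n e → relevant P n e ≡ true →
    sumV e ≡ n × isChain (support (vertices P) e) ≡ true × framedInI P ⊥ (sortC (support (vertices P) e)) ⊤ ≡ true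
  relevant⁻ n e h = ≤-antisym (≤ᵇ-true⇒≤ (∧-true⁻ˡ sum≡n)) (≤ᵇ-true⇒≤ (∧-true⁻ʳ {sumV e ≤ᵇ n} sum≡n)) ,
                    ∧-true⁻ˡ rest , not-not (∧-true⁻ʳ {isChain (support (vertices P) e)} rest)
    where
    sum≡n = ∧-true⁻ˡ h
    rest  = ∧-true⁻ʳ {(sumV e ≤ᵇ n) ∧ (n ≤ᵇ sumV e)} h
    not-not : ∀ {b} → not (not b) ≡ true → b ≡ true
    not-not {true} _ = refl

module Correspondence {d : ℕ} (P : ColoringProblem d) (n : ℕ) where
  open Multiset (_≟ₛ_ {d})
  open Sorted (λ {S} {T} → ⊆-antisym {d} S T) using (sorted-↭⇒≡)

  vs : List (Subset d)
  vs = vertices P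

  Proper : Vec (Fin (suc n)) d → Set
  Proper f = isProper P (suc n) f ≡ true

  Relevant : Vec ℕ (length vs) → Set
  Relevant e = relevant P n e ≡ true

  monomial : Vec (Fin (suc n)) d → Vec ℕ (length vs)
  monomial f = tally vs (multichain n f)

  colouringOf : Vec ℕ (length vs) → Vec (Fin (suc n)) d
  colouringOf e = colouring n (sortC (expand vs e))

  diagonal : ∀ {z} → z ∈ vs → I P z z ≡ true
  diagonal z∈ = I-diag P _ (∈-vertices⁻ P z∈)

  module _ {f} (proper : Proper f) where

    framed : framedInI P ⊥ (multichain n f) ⊤ ≡ true
    framed = trans (sym (isProper≡framedInI P n f)) proper

    multichain⊆vertices : ∀ {z} → z ∈ multichain n f → z ∈ vs
    multichain⊆vertices = ∈-vertices⁺ P ∘ framedInI⇒∈p P ⊥ (multichain n f) ⊤ framed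

    expand-monomial : expand vs (monomial f) ↭ multichain n f
    expand-monomial = expand-tally vs (vertices-unique P) (multichain n f) multichain⊆vertices

    monomial-degree : sumV (monomial f) ≡ n
    monomial-degree = trans (sym (length-expand vs (monomial f)))
                            (trans (↭-length expand-monomial) (length-applyUpTo _ n))

    monomial-relevant : Relevant (monomial f)
    monomial-relevant = relevant⁺ P n (monomial f) monomial-degree (isChain⁺ σ-comparable) (trans framed-σ framed)
      where
      σ = support vs (monomial f)
      σ⊆M : ∀ {z} → z ∈ σ → z ∈ multichain n f
      σ⊆M = ∈-resp-↭ expand-monomial ∘ ∈-support⇒∈-expand vs (monomial f)
      M⊆σ : ∀ {z} → z ∈ multichain n f → z ∈ σ
      M⊆σ = ∈-expand⇒∈-support vs (monomial f) ∘ ∈-resp-↭ (↭-sym expand-monomial)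
      σ-comparable : Comparable σ
      σ-comparable S∈ T∈ = sorted⇒comparable (multichain-sorted n f) (σ⊆M S∈) (σ⊆M T∈)
      framed-σ : framedInI P ⊥ (sortC σ) ⊤ ≡ framedInI P ⊥ (multichain n f) ⊤
      framed-σ = framedInI-same-members P ⊥ ⊤ (sortC-sorted σ σ-comparable) (multichain-sorted n f)
        (σ⊆M ∘ ∈-resp-↭ (sortC-↭ σ)) (∈-resp-↭ (↭-sym (sortC-↭ σ)) ∘ M⊆σ)
        (diagonal ∘ multichain⊆vertices ∘ σ⊆M ∘ ∈-resp-↭ (sortC-↭ σ))

  monomial-injective : ∀ {f f′} → Proper f → Proper f′ → monomial f ≡ monomial f′ → f ≡ f′
  monomial-injective {f} {f′} proper proper′ eq = begin
    f                                  ≡⟨ sym (colouring-multichain n f) ⟩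
    colouring n (multichain n f)       ≡⟨ cong (colouring n) multichains-equal ⟩
    colouring n (multichain n f′)      ≡⟨ colouring-multichain n f′ ⟩
    f′                                 ∎
    where
    open ≡-Reasoning
    multichains-equal : multichain n f ≡ multichain n f′
    multichains-equal = sorted-↭⇒≡ (multichain-sorted n f) (multichain-sorted n f′)
      (↭-trans (↭-sym (expand-monomial proper))
               (subst (λ e → expand vs e ↭ multichain n f′) (sym eq) (expand-monomial proper′)))

  module _ {e} (rel : Relevant e) where

    private
      σ = support vs e
      L = sortC (expand vs e)
      degree = proj₁ (relevant⁻ P n e rel)
      σ-comparable : Comparable σ
      σ-comparable = isChain⁻ (proj₁ (proj₂ (relevant⁻ P n e rel)))
      L⊆σ : ∀ {z} → z ∈ L → z ∈ σ
      L⊆σ = ∈-expand⇒∈-support vs e ∘ ∈-resp-↭ (sortC-↭ (expand vs e))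
      σ⊆L : ∀ {z} → z ∈ σ → z ∈ L
      σ⊆L = ∈-resp-↭ (↭-sym (sortC-↭ (expand vs e))) ∘ ∈-support⇒∈-expand vs e
      L-sorted : AllPairs _⊆_ L
      L-sorted = sortC-sorted (expand vs e)
        (λ S∈ T∈ → σ-comparable (∈-expand⇒∈-support vs e S∈) (∈-expand⇒∈-support vs e T∈))

    multichain-colouringOf : multichain n (colouringOf e) ≡ L
    multichain-colouringOf = multichain-colouring n L L-sorted
      (trans (↭-length (sortC-↭ (expand vs e))) (trans (length-expand vs e) degree))

    colouringOf-proper : Proper (colouringOf e)
    colouringOf-proper = begin
      isProper P (suc n) (colouringOf e)
        ≡⟨ isProper≡framedInI P n (colouringOf e) ⟩
      framedInI P ⊥ (multichain n (colouringOf e)) ⊤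
        ≡⟨ cong (λ X → framedInI P ⊥ X ⊤) multichain-colouringOf ⟩
      framedInI P ⊥ L ⊤
        ≡⟨ framedInI-same-members P ⊥ ⊤ L-sorted (sortC-sorted σ σ-comparable)
             (∈-resp-↭ (↭-sym (sortC-↭ σ)) ∘ L⊆σ) (σ⊆L ∘ ∈-resp-↭ (sortC-↭ σ))
             (diagonal ∘ ∈-expand⁻ vs e ∘ ∈-support⇒∈-expand vs e ∘ L⊆σ) ⟩
      framedInI P ⊥ (sortC σ) ⊤
        ≡⟨ proj₂ (proj₂ (relevant⁻ P n e rel)) ⟩
      true
        ∎
      where open ≡-Reasoning

  colouringOf-injective : ∀ {e e′} → Relevant e → Relevant e′ → colouringOf e ≡ colouringOf e′ → e ≡ e′
  colouringOf-injective {e} {e′} rel rel′ eq = begin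
    e                                   ≡⟨ sym (tally-expand vs (vertices-unique P) e) ⟩
    tally vs (expand vs e)              ≡⟨ tally-resp-↭ vs (↭-sym (sortC-↭ (expand vs e))) ⟩
    tally vs (sortC (expand vs e))      ≡⟨ cong (tally vs) sorted-equal ⟩
    tally vs (sortC (expand vs e′))     ≡⟨ tally-resp-↭ vs (sortC-↭ (expand vs e′)) ⟩
    tally vs (expand vs e′)             ≡⟨ tally-expand vs (vertices-unique P) e′ ⟩
    e′                                  ∎
    where
    open ≡-Reasoning
    sorted-equal : sortC (expand vs e) ≡ sortC (expand vs e′)
    sorted-equal = trans (sym (multichain-colouringOf rel)) (trans (cong (multichain n) eq) (multichain-colouringOf rel′))

mainTheorem3 : (d : ℕ) (P : ColoringProblem d) (n : ℕ) → H P n ≡ χ P (suc n)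
mainTheorem3 d P n = ≤-antisym
  (length-filter-≤ (relevant P n) (isProper P (suc n)) colouringOf (compositions-unique (length vs) n)
    (λ _ → allVecs-complete (suc n) d _) colouringOf-proper colouringOf-injective)
  (length-filter-≤ (isProper P (suc n)) (relevant P n) monomial (allVecs-unique (suc n) d)
    (λ proper → subst (λ k → monomial _ ∈ compositions (length vs) k) (monomial-degree proper)
                      (compositions-complete (length vs) _))
    monomial-relevant monomial-injective)
  where open Correspondence P n
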